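{- For all VFS-terms $M,N$ and every variable $y$, $((M:y.N))^{\wr}=[\lambda y.N^{\wr}/k]M^{\wr}$, where the right-hand side is capture-avoiding substitution of the continuation $\lambda y.N^{\wr}$ for the variable $k$ in the CPS-command $M^{\wr}$.
   Context: Terms up to $\alpha$-equivalence. VFS: terms $M,N::=\uparrow V\mid \mathsf{C}_v(V,c)$; values $V,W::=x\mid\lambda x.M$; formal contexts $c::= x.M\mid (W,x.M)$ ($x$ bound in $M$). $(\uparrow V:c')=\mathsf{C}_v(V,c')$; $(\mathsf{C}_v(V,c):c')=\mathsf{C}_v(V,(c:c'))$; $((x.M):c')=x.(M:c')$; $((W,x.M):c')=(W,x.(M:c'))$. CPS: a fixed variable $k$. Commands $M::=kV\mid KV\mid VWK$; continuations $K::=\lambda x.M$; values $V,W::=\lambda x.P\mid x$; terms $P::=\lambda k.M$ (these are $\lambda$-terms). Negative translation: $x^{\sim}=x$; $(\lambda x.M)^{\sim}=\lambda x.M^{ - }$; $M^{ - }=\lambda k.M^{\wr}$; $(\uparrow V)^{\wr}=kV^{\sim}$; $(\mathsf{C}_v(V,x.M))^{\wr}=(\lambda x.M^{\wr})V^{\sim}$; $(\mathsf{C}_v(V,(W,x.M)))^{\wr}=V^{\sim}W^{\sim}(\lambda x.M^{\wr})$. -}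

module Defs where

-- Terms up to α-equivalence are represented with well-scoped de Bruijn
-- indices: a term in scope n has n free (ordinary) variables, numbered
-- by Fin n; a binder "x.M" is an anonymous binder over M : _ (suc n).
-- The CPS variable k is not an ordinary variable: it is a distinguished
-- constructor (kApp), bound by λk (lamk).

open import Data.Nat using (ℕ; zero; suc)
open import Data.Fin using (Fin; zero; suc)

Ren : ℕ → ℕ → Set
Ren n m = Fin n → Fin m

ext : ∀ {n m} → Ren n m → Ren (suc n) (suc m)
ext ρ zero    = zero
ext ρ (suc i) = suc (ρ i)

mutual
  data Tm (n : ℕ) : Set where
    ↑_ : Val n → Tm n
    Cv : Val n → FCtx n → Tm n

  data Val (n : ℕ) : Set where
    var : Fin n → Val n
    lam : Tm (suc n) → Val n

  data FCtx (n : ℕ) : Set where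
    bind : Tm (suc n) → FCtx n
    pair : Val n → Tm (suc n) → FCtx n

mutual
  renTm : ∀ {n m} → Ren n m → Tm n → Tm m
  renTm ρ (↑ V)    = ↑ (renVal ρ V)
  renTm ρ (Cv V c) = Cv (renVal ρ V) (renFCtx ρ c)

  renVal : ∀ {n m} → Ren n m → Val n → Val m
  renVal ρ (var i) = var (ρ i)
  renVal ρ (lam M) = lam (renTm (ext ρ) M)

  renFCtx : ∀ {n m} → Ren n m → FCtx n → FCtx m
  renFCtx ρ (bind M)   = bind (renTm (ext ρ) M)
  renFCtx ρ (pair W M) = pair (renVal ρ W) (renTm (ext ρ) M)

wkFCtx : ∀ {n} → FCtx n → FCtx (suc n)
wkFCtx = renFCtx suc

mutual
  _∶_ : ∀ {n} → Tm n → FCtx n → Tm n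
  (↑ V) ∶ c'  = Cv V c'
  Cv V c ∶ c' = Cv V (c ∶ᶜ c')

  _∶ᶜ_ : ∀ {n} → FCtx n → FCtx n → FCtx n
  bind M ∶ᶜ c'   = bind (M ∶ wkFCtx c')
  pair W M ∶ᶜ c' = pair W (M ∶ wkFCtx c')

mutual
  data Cmd (n : ℕ) : Set where
    kApp    : CVal n → Cmd n
    contApp : Cont n → CVal n → Cmd n
    app     : CVal n → CVal n → Cont n → Cmd n

  data Cont (n : ℕ) : Set where
    lamx : Cmd (suc n) → Cont n

  data CVal (n : ℕ) : Set where
    cvar : Fin n → CVal n
    clam : CTm (suc n) → CVal n

  data CTm (n : ℕ) : Set where
    lamk : Cmd n → CTm n

mutual
  renCmd : ∀ {n m} → Ren n m → Cmd n → Cmd m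
  renCmd ρ (kApp V)      = kApp (renCVal ρ V)
  renCmd ρ (contApp K V) = contApp (renCont ρ K) (renCVal ρ V)
  renCmd ρ (app V W K)   = app (renCVal ρ V) (renCVal ρ W) (renCont ρ K)

  renCont : ∀ {n m} → Ren n m → Cont n → Cont m
  renCont ρ (lamx M) = lamx (renCmd (ext ρ) M)

  renCVal : ∀ {n m} → Ren n m → CVal n → CVal m
  renCVal ρ (cvar i) = cvar (ρ i)
  renCVal ρ (clam P) = clam (renCTm (ext ρ) P)

  renCTm : ∀ {n m} → Ren n m → CTm n → CTm m
  renCTm ρ (lamk M) = lamk (renCmd ρ M)

-- CPS values contain no free k (every k
-- under a value is bound by the λk of a CPS term P), so they are left
-- unchanged; K is weakened when passing under a binder x.
mutual
  substK : ∀ {n} → Cont n → Cmd n → Cmd n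
  substK K (kApp V)      = contApp K V
  substK K (contApp L V) = contApp (substKCont K L) V
  substK K (app V W L)   = app V W (substKCont K L)

  substKCont : ∀ {n} → Cont n → Cont n → Cont n
  substKCont K (lamx M) = lamx (substK (renCont suc K) M)

mutual
  _~ : ∀ {n} → Val n → CVal n
  var x ~ = cvar x
  lam M ~ = clam (M ⁻)

  _⁻ : ∀ {n} → Tm n → CTm n
  M ⁻ = lamk (M ≀)

  _≀ : ∀ {n} → Tm n → Cmd n
  (↑ V) ≀             = kApp (V ~)
  Cv V (bind M) ≀     = contApp (lamx (M ≀)) (V ~)
  Cv V (pair W M) ≀   = app (V ~) (W ~) (lamx (M ≀))

-- Appending x.N to M only changes the innermost command of M's translation,
-- the one headed by k, into an application of λx.N≀; this is exactly what
-- substituting λx.N≀ for k does.  Passing under a binder weakens both sides,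
-- so the induction needs that the translation commutes with renaming.
module Submission where

open import Defs
open import Data.Nat using (suc)
open import Data.Fin using (Fin)
open import Relation.Binary.PropositionalEquality
  using (_≡_; refl; cong; sym; module ≡-Reasoning)

mutual
  renCVal-~ : ∀ {n m} (ρ : Ren n m) (V : Val n) → renCVal ρ (V ~) ≡ renVal ρ V ~
  renCVal-~ ρ (var x) = refl
  renCVal-~ ρ (lam M) = cong (λ C → clam (lamk C)) (renCmd-≀ (ext ρ) M)

  renCmd-≀ : ∀ {n m} (ρ : Ren n m) (M : Tm n) → renCmd ρ (M ≀) ≡ renTm ρ M ≀
  renCmd-≀ ρ (↑ V) = cong kApp (renCVal-~ ρ V)
  renCmd-≀ ρ (Cv V (bind M))
    rewrite renCVal-~ ρ V | renCmd-≀ (ext ρ) M = refl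
  renCmd-≀ ρ (Cv V (pair W M))
    rewrite renCVal-~ ρ V | renCVal-~ ρ W | renCmd-≀ (ext ρ) M = refl

renCont-wk-≀ : ∀ {n} (N : Tm (suc n)) →
               renCont Fin.suc (lamx (N ≀)) ≡ lamx (renTm (ext Fin.suc) N ≀)
renCont-wk-≀ N = cong lamx (renCmd-≀ (ext Fin.suc) N)

mutual
  lemma12-under-binder : ∀ {n} (M : Tm (suc n)) (N : Tm (suc n)) →
                         ((M ∶ wkFCtx (bind N)) ≀) ≡ substK (renCont Fin.suc (lamx (N ≀))) (M ≀)
  lemma12-under-binder M N = begin
    (M ∶ bind (renTm (ext Fin.suc) N)) ≀             ≡⟨ lemma12 M (renTm (ext Fin.suc) N) ⟩
    substK (lamx (renTm (ext Fin.suc) N ≀)) (M ≀)    ≡⟨ cong (λ K → substK K (M ≀)) (sym (renCont-wk-≀ N)) ⟩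
    substK (renCont Fin.suc (lamx (N ≀))) (M ≀)      ∎
    where open ≡-Reasoning

  lemma12 : ∀ {n} (M : Tm n) (N : Tm (suc n)) →
            ((M ∶ bind N) ≀) ≡ substK (lamx (N ≀)) (M ≀)
  lemma12 (↑ V) N = refl
  lemma12 (Cv V (bind M)) N =
    cong (λ C → contApp (lamx C) (V ~)) (lemma12-under-binder M N)
  lemma12 (Cv V (pair W M)) N =
    cong (λ C → app (V ~) (W ~) (lamx C)) (lemma12-under-binder M N)
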